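{- Let $n\geqslant 4$ and $2<m<n$. The set $\{r_n,r_m,r_2\}$ generates $\mathrm{Sym}_n$ if and only if one of the following holds: (i) $n$ is even and $m=n-1$; (ii) $n$ is odd and either (a) $n\equiv 0$ or $2\pmod 3$ and $m\in\{n-1,n-2\}$, or (b) $n\equiv 1\pmod 3$ and $m\in\{n-3,n-2,n-1\}$.
   Context: $\mathrm{Sym}_n$ is the symmetric group on $\{1,\dots,n\}$. For $1< i\leqslant n$, the prefix reversal $r_i\in\mathrm{Sym}_n$ is the permutation with $r_i(j)=i+1-j$ for $1\leqslant j\leqslant i$ and $r_i(j)=j$ for $i<j\leqslant n$. -}

module Defs where

open import Data.Nat using (ℕ; zero; suc; _∸_; _≤_; _<_; s≤s; z≤n)
open import Data.Nat.Properties
  using (<-≤-trans; ≤-<-trans; m∸n≤m; m∸[m∸n]≡n; _<?_; n<1+n; ≤-pred)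
open import Data.Fin using (Fin; toℕ; fromℕ<)
open import Data.Fin.Properties using (toℕ-fromℕ<; toℕ-injective)
open import Data.Fin.Permutation using (Permutation′; permutation; _⟨$⟩ʳ_; _∘ₚ_; flip; id)
open import Data.List using (List)
open import Data.List.Membership.Propositional using (_∈_)
open import Data.Product using (∃; _×_)
open import Relation.Nullary using (yes; no; contradiction)
open import Relation.Binary.PropositionalEquality using (_≡_; refl; sym; trans; cong; subst)

-- Sym_n is represented by  Permutation′ n = Fin n ↔ Fin n  (stdlib),
-- acting on the 0-indexed set Fin n ≅ {1,…,n} (k ↦ k+1).

private
  refl-lt : ∀ {i j} → j < i → i ∸ 1 ∸ j < i
  refl-lt {suc i} {j} _ = s≤s (m∸n≤m i j)

  refl-inv : ∀ {i j} → j < i → i ∸ 1 ∸ (i ∸ 1 ∸ j) ≡ j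
  refl-inv {suc i} {j} j<i = m∸[m∸n]≡n (≤-pred j<i)

-- 0-indexed prefix reversal on Fin n: j ↦ (i - 1) - j for j < i, j ↦ j otherwise.
-- In 1-indexed terms this is exactly r_i : j ↦ i + 1 - j for 1 ≤ j ≤ i.
revFun : ∀ {n} (i : ℕ) → i ≤ n → Fin n → Fin n
revFun i i≤n j with toℕ j <? i
... | yes j<i = fromℕ< (<-≤-trans (refl-lt j<i) i≤n)
... | no _ = j

revFun-invol : ∀ {n} (i : ℕ) (i≤n : i ≤ n) (j : Fin n) → revFun i i≤n (revFun i i≤n j) ≡ j
revFun-invol i i≤n j with toℕ j <? i
... | no ¬j<i with toℕ j <? i
...   | yes j<i = contradiction j<i ¬j<i
...   | no _ = refl
revFun-invol i i≤n j | yes j<i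
  with toℕ (fromℕ< (<-≤-trans (refl-lt j<i) i≤n)) <? i
...   | no ¬p = contradiction
                 (subst (_< i) (sym (toℕ-fromℕ< (<-≤-trans (refl-lt j<i) i≤n))) (refl-lt j<i)) ¬p
...   | yes p = toℕ-injective
                 (trans (toℕ-fromℕ< _)
                   (trans (cong (λ x → i ∸ 1 ∸ x) (toℕ-fromℕ< (<-≤-trans (refl-lt j<i) i≤n)))
                          (refl-inv j<i)))

r : ∀ {n} (i : ℕ) → i ≤ n → Permutation′ n
r i i≤n = permutation (revFun i i≤n) (revFun i i≤n) (revFun-invol i i≤n) (revFun-invol i i≤n)

_≈ₚ_ : ∀ {n} → Permutation′ n → Permutation′ n → Set
π ≈ₚ σ = ∀ j → π ⟨$⟩ʳ j ≡ σ ⟨$⟩ʳ j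

data InSubgroup {n} (S : List (Permutation′ n)) : Permutation′ n → Set where
  gen  : ∀ {π} → π ∈ S → InSubgroup S π
  unit : InSubgroup S id
  comp : ∀ {π σ} → InSubgroup S π → InSubgroup S σ → InSubgroup S (π ∘ₚ σ)
  inv  : ∀ {π} → InSubgroup S π → InSubgroup S (flip π)

Generates : ∀ {n} → List (Permutation′ n) → Set
Generates {n} S = ∀ (π : Permutation′ n) → ∃ λ σ → InSubgroup S σ × (σ ≈ₚ π)

{-# OPTIONS --safe #-}
module Submission where

-- Write d = n − m. Conjugating a transposition by a generator gives a transposition, so the
-- pairs (a, b) whose transposition lies in ⟨r_n, r_m, r_2⟩ form an equivalence relation that
-- is stable under every r_k; it contains (0, 1) since r_2 = (0 1), and r_n r_m translates
-- [0, m) by d. So all of Sym_n is generated as soon as (a, a + 1) is related for every a < d: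
-- trivially for d = 1, via the mirror image under r_n of the last pair (m − 1, m) when d = 2
-- and n is odd, and via a chain through the multiples of 2d when d = 3 and n ≡ 1 (mod 6).
-- In every other case some relation between positions is preserved by the three generators
-- but not by all of Sym_n: lying in the same block of size c when c divides n and d; being
-- congruent modulo d to one of 0, 1, n − 1, n − 2 when d ≥ 3; and, when d = 3 and
-- n ≡ 4 (mod 6), the parity of ⌊(a + 1)/3⌋.

open import Defs
open import Data.Nat using (ℕ; zero; suc; pred; _+_; _*_; _∸_; _≤_; _<_; _%_; _/_; s≤s; z≤n; z<s; NonZero)
open import Data.Nat.Properties
open import Data.Fin using (Fin; toℕ; fromℕ<)
open import Data.Fin.Properties using (toℕ-fromℕ<; toℕ-injective; toℕ<n) renaming (_≟_ to _≟ᶠ_)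
open import Data.Fin.Permutation using (Permutation′; _⟨$⟩ʳ_; _⟨$⟩ˡ_; _∘ₚ_; flip; id; transpose; inverseˡ; inverseʳ)
open import Data.Fin.Permutation.Transposition.List using (eval; decompose; eval-decompose)
open import Data.Nat.DivMod
open import Data.Nat.Divisibility using (_∣_; divides; n∣m*n; ∣m+n∣m⇒∣n; ∣⇒≤; ∣-refl; ∣-trans; m%n≡0⇒n∣m)
open import Data.Nat.Tactic.RingSolver using (solve-∀)
open import Data.List using (List; _∷_; [])
open import Data.List.Membership.Propositional using (_∈_)
open import Data.List.Relation.Unary.Any using (here; there)
open import Data.Product using (∃; _×_; _,_)
open import Data.Sum using (_⊎_; inj₁; inj₂)
open import Data.Unit using (⊤)
open import Data.Empty using (⊥; ⊥-elim)
open import Function using (_∘_)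
open import Function.Bundles using (_⇔_; mk⇔; Equivalence)
open import Function.Construct.Composition using (_⇔-∘_)
open import Function.Construct.Identity using (⇔-id)
open import Function.Construct.Symmetry using (⇔-sym)
open import Relation.Nullary using (¬_; Dec; yes; no; contradiction)
open import Relation.Binary.PropositionalEquality

private variable
  n : ℕ
  i j k : Fin n

-- Transpositions and subgroups of Sym_n

transpose-matchˡ : (i j : Fin n) → transpose i j ⟨$⟩ʳ i ≡ j
transpose-matchˡ i j with i ≟ᶠ i
... | yes _ = refl
... | no i≢i = contradiction refl i≢i

transpose-matchʳ : (i j : Fin n) → transpose i j ⟨$⟩ʳ j ≡ i
transpose-matchʳ i j with j ≟ᶠ i
... | yes refl = refl
... | no _ with j ≟ᶠ j
...   | yes _ = refl
...   | no j≢j = contradiction refl j≢j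

transpose-other : k ≢ i → k ≢ j → transpose i j ⟨$⟩ʳ k ≡ k
transpose-other {k = k} {i} {j} k≢i k≢j with k ≟ᶠ i
... | yes k≡i = contradiction k≡i k≢i
... | no _ with k ≟ᶠ j
...   | yes k≡j = contradiction k≡j k≢j
...   | no _ = refl

transpose-unique : (f : Fin n → Fin n) → f i ≡ j → f j ≡ i → (∀ {k} → k ≢ i → k ≢ j → f k ≡ k) →
                   ∀ x → f x ≡ transpose i j ⟨$⟩ʳ x
transpose-unique {n} {i} {j} f fi fj fk x = by-cases (x ≟ᶠ i) (x ≟ᶠ j)
  where
    τ : Fin n → Fin n
    τ = transpose i j ⟨$⟩ʳ_
    by-cases : Dec (x ≡ i) → Dec (x ≡ j) → f x ≡ τ x
    by-cases (yes x≡i) _ = trans (cong f x≡i) (trans fi (sym (trans (cong τ x≡i) (transpose-matchˡ i j))))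
    by-cases (no _) (yes x≡j) = trans (cong f x≡j) (trans fj (sym (trans (cong τ x≡j) (transpose-matchʳ i j))))
    by-cases (no x≢i) (no x≢j) = trans (fk x≢i x≢j) (sym (transpose-other x≢i x≢j))

transpose-comm : transpose j i ≈ₚ transpose i j
transpose-comm {j = j} {i} = transpose-unique _ (transpose-matchʳ j i) (transpose-matchˡ j i)
                               (λ k≢i k≢j → transpose-other k≢j k≢i)

transpose-self : id ≈ₚ transpose i i
transpose-self = transpose-unique _ refl refl (λ _ _ → refl)

-- _∘ₚ_ composes left to right: the left-hand side is x ↦ g (τ (g⁻¹ x)).
transpose-conj : (g : Permutation′ n) →
                 (flip g ∘ₚ (transpose i j ∘ₚ g)) ≈ₚ transpose (g ⟨$⟩ʳ i) (g ⟨$⟩ʳ j)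
transpose-conj {i = i} {j} g =
  transpose-unique _ (undo (transpose-matchˡ i j)) (undo (transpose-matchʳ i j)) λ k≢gi k≢gj →
    trans (cong (g ⟨$⟩ʳ_) (transpose-other (unmoved k≢gi) (unmoved k≢gj))) (inverseʳ g)
  where
    undo : ∀ {l l′} → transpose i j ⟨$⟩ʳ l ≡ l′ → g ⟨$⟩ʳ (transpose i j ⟨$⟩ʳ (g ⟨$⟩ˡ (g ⟨$⟩ʳ l))) ≡ g ⟨$⟩ʳ l′
    undo τl≡l′ = cong (g ⟨$⟩ʳ_) (trans (cong (transpose i j ⟨$⟩ʳ_) (inverseˡ g)) τl≡l′)
    unmoved : ∀ {k l} → k ≢ g ⟨$⟩ʳ l → g ⟨$⟩ˡ k ≢ l
    unmoved k≢gl refl = k≢gl (sym (inverseʳ g))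

module Subgroup (S : List (Permutation′ n)) where

  record Generated (π : Permutation′ n) : Set where
    constructor generated
    field
      {witness} : Permutation′ n
      member    : InSubgroup S witness
      equal     : witness ≈ₚ π

  generated-resp : ∀ {π π′} → π ≈ₚ π′ → Generated π → Generated π′
  generated-resp π≈π′ (generated σ∈ σ≈π) = generated σ∈ λ x → trans (σ≈π x) (π≈π′ x)

  generated-gen : ∀ {π} → π ∈ S → Generated π
  generated-gen π∈S = generated (gen π∈S) λ _ → refl

  generated-id : Generated id
  generated-id = generated unit λ _ → refl

  generated-∘ : ∀ {π σ} → Generated π → Generated σ → Generated (π ∘ₚ σ)
  generated-∘ {σ = σ} (generated π′∈ π′≈π) (generated σ′∈ σ′≈σ) =
    generated (comp π′∈ σ′∈) λ x → trans (σ′≈σ _) (cong (σ ⟨$⟩ʳ_) (π′≈π x))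

  generated-flip : ∀ {π} → Generated π → Generated (flip π)
  generated-flip {π} (generated {σ} σ∈ σ≈π) = generated (inv σ∈) λ x → begin
      σ ⟨$⟩ˡ x                   ≡⟨ inverseˡ π ⟨
      π ⟨$⟩ˡ (π ⟨$⟩ʳ (σ ⟨$⟩ˡ x)) ≡⟨ cong (π ⟨$⟩ˡ_) (σ≈π _) ⟨
      π ⟨$⟩ˡ (σ ⟨$⟩ʳ (σ ⟨$⟩ˡ x)) ≡⟨ cong (π ⟨$⟩ˡ_) (inverseʳ σ) ⟩
      π ⟨$⟩ˡ x                   ∎
    where open ≡-Reasoning

  transpose-generated-refl : Generated (transpose i i)
  transpose-generated-refl = generated-resp transpose-self generated-id

  transpose-generated-sym : Generated (transpose i j) → Generated (transpose j i)
  transpose-generated-sym = generated-resp transpose-comm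

  transpose-generated-conj : ∀ {g} → Generated g → Generated (transpose i j) →
                             Generated (transpose (g ⟨$⟩ʳ i) (g ⟨$⟩ʳ j))
  transpose-generated-conj {g = g} g∈ τ∈ =
    generated-resp (transpose-conj g) (generated-∘ (generated-flip g∈) (generated-∘ τ∈ g∈))

  transpose-generated-trans : Generated (transpose i j) → Generated (transpose j k) → Generated (transpose i k)
  transpose-generated-trans {i = i} {j} {k} ij∈ jk∈ with k ≟ᶠ i | k ≟ᶠ j
  ... | yes refl | _        = transpose-generated-refl
  ... | no _     | yes refl = ij∈
  ... | no k≢i   | no k≢j   =
    subst₂ (λ x y → Generated (transpose x y)) (transpose-matchʳ i j) (transpose-other k≢i k≢j)
      (transpose-generated-conj ij∈ jk∈)

  generated-eval : (∀ i j → Generated (transpose i j)) → ∀ τs → Generated (eval τs)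
  generated-eval all-τ []             = generated-id
  generated-eval all-τ ((i , j) ∷ τs) = generated-∘ (all-τ i j) (generated-eval all-τ τs)

  generates-if-transpositions : (∀ i j → Generated (transpose i j)) → Generates S
  generates-if-transpositions all-τ π
    with generated σ∈ σ≈π ← generated-resp {π′ = π} (eval-decompose π)
                                             (generated-eval all-τ (decompose π)) = _ , σ∈ , σ≈π

  module _ (E : Fin n → Fin n → Set) where

    Preserves : Permutation′ n → Set
    Preserves π = ∀ {i j} → E i j ⇔ E (π ⟨$⟩ʳ i) (π ⟨$⟩ʳ j)

    preserves-involution : ∀ {π} → (∀ i → π ⟨$⟩ʳ (π ⟨$⟩ʳ i) ≡ i) →
                           (∀ {i j} → E i j → E (π ⟨$⟩ʳ i) (π ⟨$⟩ʳ j)) → Preserves π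
    preserves-involution π² forth = mk⇔ forth (λ e → subst₂ E (π² _) (π² _) (forth e))

    preserves-resp : ∀ {π σ} → π ≈ₚ σ → Preserves π → Preserves σ
    preserves-resp π≈σ pres = subst (E _ _ ⇔_) (cong₂ E (π≈σ _) (π≈σ _)) pres

    subgroup-preserves : (∀ {g} → g ∈ S → Preserves g) → ∀ {π} → InSubgroup S π → Preserves π
    subgroup-preserves gens (gen g∈S) = gens g∈S
    subgroup-preserves gens unit = ⇔-id _
    subgroup-preserves gens (comp π∈ σ∈) = subgroup-preserves gens σ∈ ⇔-∘ subgroup-preserves gens π∈
    subgroup-preserves gens (inv {π} π∈) =
      ⇔-sym (subst (E _ _ ⇔_) (cong₂ E (inverseʳ π) (inverseʳ π)) (subgroup-preserves gens π∈))

    generates⇒preserved-trivial : Generates S → (∀ {g} → g ∈ S → Preserves g) →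
                                  k ≢ i → k ≢ j → E k i → E k j
    generates⇒preserved-trivial {k = k} {i} {j} all gens k≢i k≢j eki
      with σ , σ∈ , σ≈τ ← all (transpose i j) =
      subst₂ E (transpose-other k≢i k≢j) (transpose-matchˡ i j)
        (Equivalence.to (preserves-resp {σ} {transpose i j} σ≈τ (subgroup-preserves gens σ∈)) eki)

-- Prefix reversals acting on positions

reflect : ℕ → ℕ → ℕ
reflect k a with a <? k
... | yes _ = k ∸ 1 ∸ a
... | no  _ = a

toℕ-r : ∀ k (k≤n : k ≤ n) i → toℕ (r k k≤n ⟨$⟩ʳ i) ≡ reflect k (toℕ i)
toℕ-r k k≤n i with toℕ i <? k
... | yes _ = toℕ-fromℕ< _
... | no  _ = refl

reflect-mirror : ∀ {a b k} → suc (a + b) ≡ k → reflect k a ≡ b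
reflect-mirror {a} {b} refl with a <? suc (a + b)
... | yes _ = m+n∸m≡n a b
... | no a≮ = contradiction (s≤s (m≤m+n a b)) a≮

reflect-≥ : ∀ {a k} → k ≤ a → reflect k a ≡ a
reflect-≥ {a} {k} k≤a with a <? k
... | yes a<k = contradiction k≤a (<⇒≱ a<k)
... | no  _   = refl

reflect-+ : ∀ {a k} → a < k → suc (a + reflect k a) ≡ k
reflect-+ {a} a<k with b , refl ← m≤n⇒∃[o]m+o≡n a<k = cong (λ x → suc (a + x)) (reflect-mirror {a} {b} refl)

reflect-suc : ∀ {a k} → a < k → suc (reflect k a) ≡ reflect (suc (suc k)) (suc a)
reflect-suc {a} {k} a<k =
  sym (reflect-mirror {suc a} {suc (reflect k a)} (cong (suc ∘ suc) (trans (+-suc a _) (reflect-+ a<k))))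

label-reflect₂ : ∀ {A : Set} (L : ℕ → A) → L 0 ≡ L 1 → ∀ a → L (reflect 2 a) ≡ L a
label-reflect₂ L L0≡L1 0             = sym L0≡L1
label-reflect₂ L L0≡L1 1             = L0≡L1
label-reflect₂ L L0≡L1 (suc (suc a)) = cong L (reflect-≥ (s≤s (s≤s z≤n)))

%-cong-+ : ∀ {a b x y} c .{{_ : NonZero c}} → a % c ≡ b % c → x % c ≡ y % c → (a + x) % c ≡ (b + y) % c
%-cong-+ {a} {b} {x} {y} c a≡b x≡y = begin
    (a + x) % c           ≡⟨ %-distribˡ-+ a x c ⟩
    (a % c + x % c) % c   ≡⟨ cong₂ (λ u v → (u + v) % c) a≡b x≡y ⟩
    (b % c + y % c) % c   ≡⟨ %-distribˡ-+ b y c ⟨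
    (b + y) % c           ∎
  where open ≡-Reasoning

%-cancelʳ-+ : ∀ {a b} x c .{{_ : NonZero c}} → (a + x) % c ≡ (b + x) % c → a % c ≡ b % c
%-cancelʳ-+ {a} {b} x c ax≡bx = begin
    a % c                       ≡⟨ [m+kn]%n≡m%n a x c ⟨
    (a + x * c) % c             ≡⟨ cong (_% c) (complete a) ⟩
    (a + x + x * pred c) % c    ≡⟨ %-cong-+ c ax≡bx refl ⟩
    (b + x + x * pred c) % c    ≡⟨ cong (_% c) (complete b) ⟨
    (b + x * c) % c             ≡⟨ [m+kn]%n≡m%n b x c ⟩
    b % c                       ∎
  where
    open ≡-Reasoning
    complete : ∀ y → y + x * c ≡ y + x + x * pred c
    complete y = begin
      y + x * c                ≡⟨ cong (λ z → y + x * z) (suc-pred c) ⟨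
      y + x * suc (pred c)     ≡⟨ cong (y +_) (*-suc x (pred c)) ⟩
      y + (x + x * pred c)     ≡⟨ +-assoc y x _ ⟨
      y + x + x * pred c       ∎

%-small-shift : ∀ {s} x c .{{_ : NonZero c}} → 0 < s → s < c → (s + x) % c ≢ x % c
%-small-shift {s} x c 0<s s<c sx≡x = <⇒≢ 0<s (begin
    0       ≡⟨ m<n⇒m%n≡m (<-trans 0<s s<c) ⟨
    0 % c   ≡⟨ %-cancelʳ-+ x c sx≡x ⟨
    s % c   ≡⟨ m<n⇒m%n≡m s<c ⟩
    s       ∎)
  where open ≡-Reasoning

reflect-%-cong : ∀ {a b k} c .{{_ : NonZero c}} → a < k → b < k → a % c ≡ b % c →
                 reflect k a % c ≡ reflect k b % c
reflect-%-cong {a} {b} {k} c a<k b<k a≡b = %-cancelʳ-+ (suc a) c (begin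
    (reflect k a + suc a) % c   ≡⟨ cong (_% c) (+-comm (reflect k a) (suc a)) ⟩
    (suc a + reflect k a) % c   ≡⟨ cong (_% c) (trans (reflect-+ a<k) (sym (reflect-+ b<k))) ⟩
    (suc b + reflect k b) % c   ≡⟨ cong (_% c) (+-comm (suc b) (reflect k b)) ⟩
    (reflect k b + suc b) % c   ≡⟨ %-cong-+ {x = suc b} c refl (%-cong-+ {x = b} c refl (sym a≡b)) ⟩
    (reflect k b + suc a) % c   ∎)
  where open ≡-Reasoning

[s+q*c]/c≡q : ∀ {s} q c .{{_ : NonZero c}} → s < c → (s + q * c) / c ≡ q
[s+q*c]/c≡q {s} q c s<c = trans (+-distrib-/-∣ʳ s (n∣m*n q)) (cong₂ _+_ (m<n⇒m/n≡0 s<c) (m*n/n≡m q c))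

-- If a = s + q c with s < c, then K c − 1 − a = (c − 1 − s) + (K − 1 − q) c.
reflect-/ : ∀ K c .{{_ : NonZero c}} a → reflect (K * c) a / c ≡ reflect K (a / c)
reflect-/ K c a with <-≤-connex a (K * c)
... | inj₂ Kc≤a = trans (cong (_/ c) (reflect-≥ Kc≤a))
                        (sym (reflect-≥ (subst (_≤ a / c) (m*n/n≡m K c) (/-monoˡ-≤ c Kc≤a))))
... | inj₁ a<Kc
  with t , K≡ ← m≤n⇒∃[o]m+o≡n (m<n*o⇒m/o<n {a} {K} {c} a<Kc)
     | u , c≡ ← m≤n⇒∃[o]m+o≡n (m%n<n a c) = begin
    reflect (K * c) a / c   ≡⟨ cong (_/ c) (reflect-mirror mirror) ⟩
    (u + t * c) / c         ≡⟨ [s+q*c]/c≡q t c (subst (u <_) c≡ (s≤s (m≤n+m u s))) ⟩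
    t                       ≡⟨ reflect-mirror K≡ ⟨
    reflect K (a / c)       ∎
  where
    open ≡-Reasoning
    s q : ℕ
    s = a % c
    q = a / c
    regroup : ∀ s q c u t → suc (s + q * c + (u + t * c)) ≡ suc (s + u) + (q + t) * c
    regroup = solve-∀
    mirror : suc (a + (u + t * c)) ≡ K * c
    mirror = begin
      suc (a + (u + t * c))           ≡⟨ cong (λ x → suc (x + (u + t * c))) (m≡m%n+[m/n]*n a c) ⟩
      suc (s + q * c + (u + t * c))   ≡⟨ regroup s q c u t ⟩
      suc (s + u) + (q + t) * c       ≡⟨ cong (_+ (q + t) * c) c≡ ⟩
      suc (q + t) * c                 ≡⟨ cong (_* c) K≡ ⟩
      K * c                           ∎

reflect-suc-/ : ∀ {a k} K c .{{_ : NonZero c}} → suc (suc k) ≡ K * c → a < k →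
                suc (reflect k a) / c ≡ reflect K (suc a / c)
reflect-suc-/ {a} {k} K c k+2≡Kc a<k = begin
    suc (reflect k a) / c             ≡⟨ cong (_/ c) (reflect-suc a<k) ⟩
    reflect (suc (suc k)) (suc a) / c ≡⟨ cong (λ x → reflect x (suc a) / c) k+2≡Kc ⟩
    reflect (K * c) (suc a) / c       ≡⟨ reflect-/ K c (suc a) ⟩
    reflect K (suc a / c)             ∎
  where open ≡-Reasoning

reflect-odd-%2 : ∀ {q} J → q < suc (2 * J) → reflect (suc (2 * J)) q % 2 ≡ q % 2
reflect-odd-%2 {q} J q<2J+1 = %-cancelʳ-+ {q′} {q} q 2 (begin
    (q′ + q) % 2   ≡⟨ cong (_% 2) (trans (+-comm q′ q) (suc-injective (reflect-+ q<2J+1))) ⟩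
    (2 * J) % 2    ≡⟨ even J ⟩
    0              ≡⟨ even q ⟨
    (2 * q) % 2    ≡⟨ cong (λ x → (q + x) % 2) (+-identityʳ q) ⟩
    (q + q) % 2    ∎)
  where
    open ≡-Reasoning
    q′ : ℕ
    q′ = reflect (suc (2 * J)) q
    even : ∀ x → (2 * x) % 2 ≡ 0
    even x = trans (cong (_% 2) (*-comm 2 x)) (m*n%n≡0 x 2)

-- The subgroup generated by r_n, r_m and r_2

reversals : ∀ {n m} → 2 < m → m < n → List (Permutation′ n)
reversals {n} {m} 2<m m<n = r n ≤-refl ∷ r m (<⇒≤ m<n) ∷ r 2 (<⇒≤ (<-trans 2<m m<n)) ∷ []

module Reversals (n m d′ : ℕ) (m+d≡n : m + suc d′ ≡ n) (2<m : 2 < m) (m<n : m < n) where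

  d : ℕ
  d = suc d′

  S : List (Permutation′ n)
  S = reversals 2<m m<n

  open Subgroup S public

  rₙ∈S : r n ≤-refl ∈ S
  rₙ∈S = here refl

  rₘ∈S : r m (<⇒≤ m<n) ∈ S
  rₘ∈S = there (here refl)

  r₂∈S : r 2 (<⇒≤ (<-trans 2<m m<n)) ∈ S
  r₂∈S = there (there (here refl))

  2<n : 2 < n
  2<n = <-trans 2<m m<n

  0<n : 0 < n
  0<n = <-trans z<s 2<n

  1<n : 1 < n
  1<n = <-trans (s≤s z<s) 2<n

  d≤n : d ≤ n
  d≤n = subst (d ≤_) m+d≡n (m≤n+m d m)

  +d<n⇒<m : ∀ {a} → a + d < n → a < m
  +d<n⇒<m {a} a+d<n = +-cancelʳ-< d a m (subst (a + d <_) (sym m+d≡n) a+d<n)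

  reflect-shift : ∀ {a} → a < m → reflect n (reflect m a) ≡ a + d
  reflect-shift {a} a<m = reflect-mirror (begin
      suc (reflect m a + (a + d))  ≡⟨ cong suc (+-assoc (reflect m a) a d) ⟨
      suc (reflect m a + a + d)    ≡⟨ cong (λ x → suc (x + d)) (+-comm (reflect m a) a) ⟩
      suc (a + reflect m a) + d    ≡⟨ cong (_+ d) (reflect-+ a<m) ⟩
      m + d                        ≡⟨ m+d≡n ⟩
      n                            ∎)
    where open ≡-Reasoning

  infix 4 _⇄_
  record _⇄_ (a b : ℕ) : Set where
    constructor swap
    field
      {left right}  : Fin n
      toℕ-left      : toℕ left ≡ a
      toℕ-right     : toℕ right ≡ b
      transposition : Generated (transpose left right)

  ⇄-refl : ∀ {a} → a < n → a ⇄ a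
  ⇄-refl a<n = swap (toℕ-fromℕ< a<n) (toℕ-fromℕ< a<n) transpose-generated-refl

  ⇄-sym : ∀ {a b} → a ⇄ b → b ⇄ a
  ⇄-sym (swap i≡a j≡b τ∈) = swap j≡b i≡a (transpose-generated-sym τ∈)

  ⇄-trans : ∀ {a b c} → a ⇄ b → b ⇄ c → a ⇄ c
  ⇄-trans (swap {_} {j} i≡a j≡b ij∈) (swap {j′} {k} j′≡b k≡c j′k∈) =
    swap i≡a k≡c (transpose-generated-trans ij∈ (subst (λ x → Generated (transpose x k)) j′≡j j′k∈))
    where
      j′≡j : j′ ≡ j
      j′≡j = toℕ-injective (trans j′≡b (sym j≡b))

  ⇄⇒generated : toℕ i ⇄ toℕ j → Generated (transpose i j)
  ⇄⇒generated (swap i′≡i j′≡j τ∈) =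
    subst₂ (λ x y → Generated (transpose x y)) (toℕ-injective i′≡i) (toℕ-injective j′≡j) τ∈

  ⇄-reflect : ∀ {k} {k≤n : k ≤ n} {a b} → r k k≤n ∈ S → a ⇄ b → reflect k a ⇄ reflect k b
  ⇄-reflect {k} {k≤n} r∈S (swap {i} {j} refl refl τ∈) =
    swap (toℕ-r k k≤n i) (toℕ-r k k≤n j) (transpose-generated-conj (generated-gen r∈S) τ∈)

  ⇄-reflectₙ : ∀ {a b} → a ⇄ b → reflect n a ⇄ reflect n b
  ⇄-reflectₙ = ⇄-reflect {n} {≤-refl} rₙ∈S

  ⇄-reflectₘ : ∀ {a b} → a ⇄ b → reflect m a ⇄ reflect m b
  ⇄-reflectₘ = ⇄-reflect {m} {<⇒≤ m<n} rₘ∈S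

  0⇄1 : 0 ⇄ 1
  0⇄1 = swap (toℕ-fromℕ< 0<n) (toℕ-fromℕ< 1<n) (generated-resp r₂≈τ (generated-gen r₂∈S))
    where
      i₀ i₁ : Fin n
      i₀ = fromℕ< 0<n
      i₁ = fromℕ< 1<n
      r₂ : Permutation′ n
      r₂ = r 2 (<⇒≤ 2<n)
      toℕ-≢ : ∀ {a} (a<n : a < n) {k} → k ≢ fromℕ< a<n → toℕ k ≢ a
      toℕ-≢ a<n k≢ toℕk≡a = k≢ (toℕ-injective (trans toℕk≡a (sym (toℕ-fromℕ< a<n))))
      ≥2 : ∀ {x} → x ≢ 0 → x ≢ 1 → 2 ≤ x
      ≥2 {0}           x≢0 _   = contradiction refl x≢0
      ≥2 {1}           _   x≢1 = contradiction refl x≢1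
      ≥2 {suc (suc x)} _   _   = s≤s (s≤s z≤n)
      swaps : ∀ {a b} (a<n : a < n) (b<n : b < n) → reflect 2 a ≡ b → r₂ ⟨$⟩ʳ fromℕ< a<n ≡ fromℕ< b<n
      swaps {a} {b} a<n b<n ρa≡b = toℕ-injective (begin
        toℕ (r₂ ⟨$⟩ʳ fromℕ< a<n)     ≡⟨ toℕ-r 2 _ (fromℕ< a<n) ⟩
        reflect 2 (toℕ (fromℕ< a<n)) ≡⟨ cong (reflect 2) (toℕ-fromℕ< a<n) ⟩
        reflect 2 a                  ≡⟨ ρa≡b ⟩
        b                            ≡⟨ toℕ-fromℕ< b<n ⟨
        toℕ (fromℕ< b<n)             ∎)
        where open ≡-Reasoning
      r₂≈τ : r₂ ≈ₚ transpose i₀ i₁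
      r₂≈τ = transpose-unique _ (swaps 0<n 1<n refl) (swaps 1<n 0<n refl) λ {k} k≢i₀ k≢i₁ →
        toℕ-injective (trans (toℕ-r 2 _ k) (reflect-≥ (≥2 (toℕ-≢ 0<n k≢i₀) (toℕ-≢ 1<n k≢i₁))))

  generates-if-adjacent : (∀ a → suc a < n → a ⇄ suc a) → Generates S
  generates-if-adjacent adjacent =
    generates-if-transpositions λ i j → ⇄⇒generated (⇄-trans (⇄-sym (0⇄ (toℕ<n i))) (0⇄ (toℕ<n j)))
    where
      0⇄ : ∀ {a} → a < n → 0 ⇄ a
      0⇄ {zero}  a<n = ⇄-refl a<n
      0⇄ {suc a} a<n = ⇄-trans (0⇄ (<-trans (n<1+n a) a<n)) (adjacent a a<n)

  shift : ∀ {a b} → a < m → b < m → a ⇄ b → a + d ⇄ b + d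
  shift a<m b<m a⇄b = subst₂ _⇄_ (reflect-shift a<m) (reflect-shift b<m) (⇄-reflectₙ (⇄-reflectₘ a⇄b))

  shift* : ∀ k {a b} → a ≤ b → b + k * d < n → a ⇄ b → a + k * d ⇄ b + k * d
  shift* zero {a} {b} _ _ a⇄b = subst₂ _⇄_ (sym (+-identityʳ a)) (sym (+-identityʳ b)) a⇄b
  shift* (suc k) {a} {b} a≤b b+d+kd<n a⇄b =
    subst₂ _⇄_ (+-assoc a d (k * d)) (+-assoc b d (k * d))
      (shift* k (+-monoˡ-≤ d a≤b) b+d+kd<n′ (shift (≤-<-trans a≤b b<m) b<m a⇄b))
    where
      b+d+kd<n′ : b + d + k * d < n
      b+d+kd<n′ = subst (_< n) (sym (+-assoc b d (k * d))) b+d+kd<n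
      b<m : b < m
      b<m = +d<n⇒<m (≤-<-trans (m≤m+n (b + d) (k * d)) b+d+kd<n′)

  adjacent-if-residues : (∀ a → a < d → suc a < n → a ⇄ suc a) → ∀ a → suc a < n → a ⇄ suc a
  adjacent-if-residues base a 1+a<n =
    subst (λ x → x ⇄ suc x) (sym a≡)
      (shift* (a / d) (n≤1+n _) (subst (_< n) (cong suc a≡) 1+a<n)
        (base (a % d) (m%n<n a d) (≤-<-trans (s≤s (m%n≤m a d)) 1+a<n)))
    where
      a≡ : a ≡ a % d + a / d * d
      a≡ = m≡m%n+[m/n]*n a d

  module _ {K : ℕ} (n≡ : n ≡ suc (suc K * d)) where

    last-pair : K * d ⇄ suc (K * d)
    last-pair = shift* K z≤n (subst (suc (K * d) <_) (sym n≡) (s≤s (m<n+m (K * d) z<s))) 0⇄1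

    reflectₙ-last : reflect n (suc (K * d)) ≡ d′
    reflectₙ-last = reflect-mirror (trans (cong (suc ∘ suc) (+-comm (K * d) d′)) (sym n≡))

    d′⇄d : d′ ⇄ d
    d′⇄d = ⇄-sym (subst₂ _⇄_ (reflect-mirror (trans (cong suc (+-comm (K * d) d)) (sym n≡))) reflectₙ-last
                            (⇄-reflectₙ last-pair))

  -- With N = n − 1 = (2j + 2) d, r_n r_m sends (m − 1, m) to (N, d − 1) and that pair to
  -- (0, 2d − 1); translates of 0 ⇄ 2d link 0 to N, which closes the chain 1 ⇄ 0 ⇄ N ⇄ d − 1.
  module _ {j : ℕ} (n≡ : n ≡ suc (suc (suc (2 * j)) * d)) where

    private
      K N : ℕ
      K = suc (2 * j)
      N = suc K * d
      m≡ : m ≡ suc (K * d)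
      m≡ = +-cancelʳ-≡ d m _ (trans m+d≡n (trans n≡ (cong suc (+-comm d (K * d)))))
      d′<m : d′ < m
      d′<m = subst (d′ <_) (sym m≡) (s≤s (≤-trans (n≤1+n d′) (m≤m+n d (2 * j * d))))
      d<m : d < m
      d<m = subst (d <_) (sym m≡) (s≤s (m≤m+n d (2 * j * d)))

    N⇄d′ : N ⇄ d′
    N⇄d′ = subst₂ _⇄_
      (trans (cong (reflect n) (reflect-mirror (trans (cong suc (+-identityʳ (K * d))) (sym m≡))))
             (reflect-mirror (sym n≡)))
      (trans (cong (reflect n) (reflect-≥ (≤-reflexive m≡))) (reflectₙ-last {K} n≡))
      (⇄-reflectₙ (⇄-reflectₘ (last-pair {K} n≡)))

    0⇄2d : 0 ⇄ d + d
    0⇄2d = ⇄-trans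
      (subst₂ _⇄_
        (trans (cong (reflect n) (reflect-≥ m≤N)) (reflect-mirror (trans (cong suc (+-identityʳ N)) (sym n≡))))
        (reflect-shift d′<m)
        (⇄-reflectₙ (⇄-reflectₘ N⇄d′)))
      (shift d′<m d<m (d′⇄d {K} n≡))
      where
        m≤N : m ≤ N
        m≤N = subst (_≤ N) (sym m≡) (s≤s (m≤n+m (K * d) d′))

    0⇄even-multiple : ∀ i → 2 * i * d < n → 0 ⇄ 2 * i * d
    0⇄even-multiple zero    _     = ⇄-refl 0<n
    0⇄even-multiple (suc i) bound =
      ⇄-trans (0⇄even-multiple i (≤-<-trans (m≤n+m _ (d + d)) bound′))
              (subst (2 * i * d ⇄_) (step i d) (shift* (2 * i) z≤n bound′ 0⇄2d))
      where
        step : ∀ i d → d + d + 2 * i * d ≡ 2 * suc i * d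
        step = solve-∀
        bound′ : d + d + 2 * i * d < n
        bound′ = subst (_< n) (sym (step i d)) bound

    1⇄d′ : 1 ⇄ d′
    1⇄d′ = ⇄-trans (⇄-sym 0⇄1) (⇄-trans (subst (0 ⇄_) 2[j+1]d≡N (0⇄even-multiple (suc j) N<n)) N⇄d′)
      where
        2[j+1]≡K+1 : ∀ j → 2 * suc j ≡ suc (suc (2 * j))
        2[j+1]≡K+1 = solve-∀
        2[j+1]d≡N : 2 * suc j * d ≡ N
        2[j+1]d≡N = cong (_* d) (2[j+1]≡K+1 j)
        N<n : 2 * suc j * d < n
        N<n = subst (_< n) (sym 2[j+1]d≡N) (subst (N <_) (sym n≡) (n<1+n N))

  Invariant : (ℕ → ℕ → Set) → ℕ → Set
  Invariant E k = ∀ {a b} → a < n → b < n → E a b → E (reflect k a) (reflect k b)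

  ¬generates-if-invariant : ∀ (E : ℕ → ℕ → Set) {c} → Invariant E n → Invariant E m → Invariant E 2 →
                            E 0 1 → ¬ E 0 c → 0 < c → c < n → ¬ Generates S
  ¬generates-if-invariant E {c} invₙ invₘ inv₂ E01 ¬E0c 0<c c<n all =
    ¬E0c (subst₂ E (toℕ-fromℕ< 0<n) (toℕ-fromℕ< c<n)
      (generates⇒preserved-trivial E′ all preserved (≢-fromℕ< 0<n 1<n λ ()) (≢-fromℕ< 0<n c<n (<⇒≢ 0<c))
        (subst₂ E (sym (toℕ-fromℕ< 0<n)) (sym (toℕ-fromℕ< 1<n)) E01)))
    where
      E′ : Fin n → Fin n → Set
      E′ i j = E (toℕ i) (toℕ j)
      ≢-fromℕ< : ∀ {a b} (a<n : a < n) (b<n : b < n) → a ≢ b → fromℕ< a<n ≢ fromℕ< b<n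
      ≢-fromℕ< a<n b<n a≢b eq = a≢b (trans (sym (toℕ-fromℕ< a<n)) (trans (cong toℕ eq) (toℕ-fromℕ< b<n)))
      reflection-preserves : ∀ {k} (k≤n : k ≤ n) → Invariant E k → Preserves E′ (r k k≤n)
      reflection-preserves {k} k≤n invₖ = preserves-involution E′ {r k k≤n} (revFun-invol k k≤n) λ {i} {j} e →
        subst₂ E (sym (toℕ-r k k≤n i)) (sym (toℕ-r k k≤n j)) (invₖ (toℕ<n i) (toℕ<n j) e)
      preserved : ∀ {g} → g ∈ S → Preserves E′ g
      preserved (here refl)                 = reflection-preserves {n} ≤-refl invₙ
      preserved (there (here refl))         = reflection-preserves {m} (<⇒≤ m<n) invₘ
      preserved (there (there (here refl))) = reflection-preserves {2} (<⇒≤ 2<n) inv₂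

  kernel-invariant : ∀ {A : Set} (L : ℕ → A) (f : A → A) {k} →
                     (∀ {a} → a < n → L (reflect k a) ≡ f (L a)) → Invariant (λ a b → L a ≡ L b) k
  kernel-invariant L f hom a<n b<n La≡Lb = trans (hom a<n) (trans (cong f La≡Lb) (sym (hom b<n)))

  predicate-invariant : ∀ (P : ℕ → Set) {k} → (∀ {a} → a < n → P (reflect k a) ⇔ P a) →
                        Invariant (λ a b → P a ⇔ P b) k
  predicate-invariant P hom a<n b<n Pa⇔Pb = ⇔-sym (hom b<n) ⇔-∘ (Pa⇔Pb ⇔-∘ hom a<n)

  ¬generates-if-blocks : ∀ {c} → 2 ≤ c → c ∣ n → c ∣ d → ¬ Generates S
  ¬generates-if-blocks {c@(suc (suc _))} 2≤c@(s≤s (s≤s _)) c∣n c∣d =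
    ¬generates-if-invariant SameBlock (blocks-invariant c∣n) (blocks-invariant c∣m)
      (kernel-invariant (_/ c) (λ x → x) {2} (λ {a} _ → label-reflect₂ (_/ c) 0/c≡1/c a))
      0/c≡1/c (λ 0≡c/c → 0≢1+n (trans 0≡c/c (n/n≡1 c))) (<-≤-trans z<s 2≤c)
      (≤-<-trans (∣⇒≤ c∣d) (subst (d <_) m+d≡n (m<n+m d (<-trans z<s 2<m))))
    where
      SameBlock : ℕ → ℕ → Set
      SameBlock a b = a / c ≡ b / c
      0/c≡1/c : 0 / c ≡ 1 / c
      0/c≡1/c = sym (m<n⇒m/n≡0 2≤c)
      c∣m : c ∣ m
      c∣m = ∣m+n∣m⇒∣n (subst (c ∣_) (trans (sym m+d≡n) (+-comm m d)) c∣n) c∣d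
      blocks-invariant : ∀ {k} → c ∣ k → Invariant SameBlock k
      blocks-invariant (divides K refl) = kernel-invariant (_/ c) (reflect K) {K * c} (λ {a} _ → reflect-/ K c a)

  -- Modulo d, both r_n and r_m (the latter below m, where m − 1 ≡ n − 1) act as x ↦ n − 1 − x,
  -- and r_2 swaps 0 and 1, so the set of positions satisfying Boundary is invariant.
  Boundary : ℕ → Set
  Boundary x = x % d ≡ 0 % d ⊎ x % d ≡ 1 % d ⊎ suc x % d ≡ n % d ⊎ suc (suc x) % d ≡ n % d

  boundary-0 : Boundary 0
  boundary-0 = inj₁ refl

  boundary-1 : Boundary 1
  boundary-1 = inj₂ (inj₁ refl)

  boundary-resp : ∀ {x y} → x % d ≡ y % d → Boundary x → Boundary y
  boundary-resp {x} {y} x≡y = λ where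
      (inj₁ x≡0)               → inj₁ (trans (sym x≡y) x≡0)
      (inj₂ (inj₁ x≡1))        → inj₂ (inj₁ (trans (sym x≡y) x≡1))
      (inj₂ (inj₂ (inj₁ x≡))) → inj₂ (inj₂ (inj₁ (trans (sym (%-cong-+ {1} {1} {x} {y} d refl x≡y)) x≡)))
      (inj₂ (inj₂ (inj₂ x≡))) → inj₂ (inj₂ (inj₂ (trans (sym (%-cong-+ {2} {2} {x} {y} d refl x≡y)) x≡)))

  boundary-mirror : ∀ {x y} → suc (x + y) ≡ n → Boundary x → Boundary y
  boundary-mirror {x} {y} x+y+1≡n = λ where
      (inj₁ x≡0)               → inj₂ (inj₂ (inj₁ (trans (%-cong-+ {0} {x} {suc y} d (sym x≡0) refl) x+1+y≡n)))
      (inj₂ (inj₁ x≡1))        → inj₂ (inj₂ (inj₂ (trans (%-cong-+ {1} {x} {suc y} d (sym x≡1) refl) x+1+y≡n)))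
      (inj₂ (inj₂ (inj₁ x≡))) → inj₁ (%-cancelʳ-+ {y} {0} (suc x) d (trans y+1+x≡n (sym x≡)))
      (inj₂ (inj₂ (inj₂ x≡))) → inj₂ (inj₁ (%-cancelʳ-+ {y} {1} (suc x) d (trans y+1+x≡n (sym x≡))))
    where
      x+1+y≡n : (x + suc y) % d ≡ n % d
      x+1+y≡n = cong (_% d) (trans (+-suc x y) x+y+1≡n)
      y+1+x≡n : (y + suc x) % d ≡ n % d
      y+1+x≡n = cong (_% d) (trans (+-comm y (suc x)) x+y+1≡n)

  boundary-reflectₙ : ∀ {a} → a < n → Boundary (reflect n a) ⇔ Boundary a
  boundary-reflectₙ {a} a<n =
    mk⇔ (boundary-mirror (trans (cong suc (+-comm (reflect n a) a)) (reflect-+ a<n)))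
        (boundary-mirror (reflect-+ a<n))

  boundary-reflectₘ : ∀ {a} → a < n → Boundary (reflect m a) ⇔ Boundary a
  boundary-reflectₘ {a} _ with <-≤-connex a m
  ... | inj₂ m≤a = subst (λ x → Boundary x ⇔ Boundary a) (sym (reflect-≥ m≤a)) (⇔-id _)
  ... | inj₁ a<m = mk⇔ (boundary-mirror mirror ∘ boundary-resp (sym y+d≡y))
                       (boundary-resp y+d≡y ∘ boundary-mirror mirror′)
    where
      y : ℕ
      y = reflect m a
      y+d≡y : (y + d) % d ≡ y % d
      y+d≡y = [m+n]%n≡m%n y d
      mirror′ : suc (a + (y + d)) ≡ n
      mirror′ = trans (cong suc (sym (+-assoc a y d))) (trans (cong (_+ d) (reflect-+ a<m)) m+d≡n)
      mirror : suc (y + d + a) ≡ n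
      mirror = trans (cong suc (+-comm (y + d) a)) mirror′

  boundary-reflect₂ : ∀ {a} → a < n → Boundary (reflect 2 a) ⇔ Boundary a
  boundary-reflect₂ {0}           _ = mk⇔ (λ _ → boundary-0) (λ _ → boundary-1)
  boundary-reflect₂ {1}           _ = mk⇔ (λ _ → boundary-1) (λ _ → boundary-0)
  boundary-reflect₂ {suc (suc a)} _ = subst (λ x → Boundary x ⇔ Boundary (suc (suc a)))
                                            (sym (reflect-≥ (s≤s (s≤s z≤n)))) (⇔-id _)

  ¬generates-if-¬boundary : ∀ {c} → 0 < c → c < n → ¬ Boundary c → ¬ Generates S
  ¬generates-if-¬boundary 0<c c<n ¬Bc =
    ¬generates-if-invariant (λ a b → Boundary a ⇔ Boundary b)
      (predicate-invariant Boundary {n} boundary-reflectₙ) (predicate-invariant Boundary {m} boundary-reflectₘ)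
      (predicate-invariant Boundary {2} boundary-reflect₂)
      (mk⇔ (λ _ → boundary-1) (λ _ → boundary-0)) (λ B0⇔Bc → ¬Bc (Equivalence.to B0⇔Bc boundary-0)) 0<c c<n

  ¬generates-if-2≤n%d : 3 ≤ d → 2 ≤ n % d → ¬ Generates S
  ¬generates-if-2≤n%d 3≤d 2≤r =
    ¬generates-if-¬boundary (<-≤-trans z<s 2≤r) (<-≤-trans (m%n<n n d) d≤n) λ where
      (inj₁ r≡0)                → <⇒≢ (<-≤-trans z<s 2≤r) (sym (trans (sym r%d≡r) r≡0))
      (inj₂ (inj₁ r≡1))         → <⇒≢ 2≤r (sym (trans (sym r%d≡r) (trans r≡1 (m<n⇒m%n≡m (<-trans (s≤s z<s) 3≤d)))))
      (inj₂ (inj₂ (inj₁ r+1≡))) → %-small-shift (n % d) d z<s (<-trans (s≤s z<s) 3≤d) (trans r+1≡ (sym r%d≡r))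
      (inj₂ (inj₂ (inj₂ r+2≡))) → %-small-shift (n % d) d z<s 3≤d (trans r+2≡ (sym r%d≡r))
    where
      r%d≡r : n % d % d ≡ n % d
      r%d≡r = m%n%n≡m%n n d

  ¬generates-if-n%d≡1 : 4 ≤ d → n % d ≡ 1 → ¬ Generates S
  ¬generates-if-n%d≡1 4≤d r≡1 = ¬generates-if-¬boundary {2} z<s 2<n λ where
      (inj₁ 2≡0)               → contradiction (trans (sym (m<n⇒m%n≡m 2<d)) 2≡0) λ ()
      (inj₂ (inj₁ 2≡1))        → contradiction (trans (sym (m<n⇒m%n≡m 2<d)) (trans 2≡1 (m<n⇒m%n≡m 1<d))) λ ()
      (inj₂ (inj₂ (inj₁ 3≡1))) → contradiction (trans (sym (m<n⇒m%n≡m 4≤d)) (trans 3≡1 r≡1)) λ ()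
      (inj₂ (inj₂ (inj₂ 4≡1))) → %-small-shift 1 d z<s 4≤d (trans 4≡1 (trans r≡1 (sym (m<n⇒m%n≡m 1<d))))
    where
      2<d : 2 < d
      2<d = ≤-trans (n≤1+n 3) 4≤d
      1<d : 1 < d
      1<d = <-trans (n<1+n 1) 2<d

  ¬generates-if-n%d≡0 : 5 ≤ d → n % d ≡ 0 → ¬ Generates S
  ¬generates-if-n%d≡0 5≤d r≡0 = ¬generates-if-¬boundary {2} z<s 2<n λ where
      (inj₁ 2≡0)               → contradiction (trans (sym (m<n⇒m%n≡m 2<d)) 2≡0) λ ()
      (inj₂ (inj₁ 2≡1))        → contradiction (trans (sym (m<n⇒m%n≡m 2<d)) (trans 2≡1 (m<n⇒m%n≡m 1<d))) λ ()
      (inj₂ (inj₂ (inj₁ 3≡0))) → contradiction (trans (sym (m<n⇒m%n≡m 3<d)) (trans 3≡0 r≡0)) λ ()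
      (inj₂ (inj₂ (inj₂ 4≡0))) → contradiction (trans (sym (m<n⇒m%n≡m 5≤d)) (trans 4≡0 r≡0)) λ ()
    where
      3<d : 3 < d
      3<d = ≤-trans (n≤1+n 4) 5≤d
      2<d : 2 < d
      2<d = <-trans (n<1+n 2) 3<d
      1<d : 1 < d
      1<d = <-trans (n<1+n 1) 2<d

  ¬generates-if-5≤d : 5 ≤ d → ¬ Generates S
  ¬generates-if-5≤d 5≤d with n % d in r≡
  ... | 0           = ¬generates-if-n%d≡0 5≤d r≡
  ... | 1           = ¬generates-if-n%d≡1 (≤-trans (n≤1+n 4) 5≤d) r≡
  ... | suc (suc _) =
    ¬generates-if-2≤n%d (≤-trans (s≤s (s≤s (s≤s z≤n))) 5≤d) (subst (2 ≤_) (sym r≡) (s≤s (s≤s z≤n)))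

-- The characterisation in terms of the gap d = n − m

%≡1⇒≡1+multiple : ∀ {n} c .{{_ : NonZero c}} → 1 < n → n % c ≡ 1 → ∃ λ K → n ≡ suc (suc K * c)
%≡1⇒≡1+multiple {n} c 1<n r≡1 with n / c | m≡m%n+[m/n]*n n c
... | zero  | n≡ = contradiction (trans n≡ (trans (+-identityʳ (n % c)) r≡1)) (>⇒≢ 1<n)
... | suc K | n≡ = K , trans n≡ (cong (_+ suc K * c) r≡1)

module _ {n m : ℕ} (2<m : 2 < m) (m<n : m < n) where

  generates-gap1 : m + 1 ≡ n → Generates (reversals 2<m m<n)
  generates-gap1 m+1≡n = generates-if-adjacent (adjacent-if-residues λ where
      0       _           _ → 0⇄1
      (suc _) (s≤s ()) _)
    where open Reversals n m 0 m+1≡n 2<m m<n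

  generates⇔gap2 : m + 2 ≡ n → Generates (reversals 2<m m<n) ⇔ n % 2 ≡ 1
  generates⇔gap2 m+2≡n = mk⇔ odd generates
    where
      open Reversals n m 1 m+2≡n 2<m m<n
      odd : Generates S → n % 2 ≡ 1
      odd all with n % 2 in r≡ | m%n<n n 2
      ... | 0           | _ = contradiction all (¬generates-if-blocks ≤-refl (m%n≡0⇒n∣m n 2 r≡) ∣-refl)
      ... | 1           | _ = refl
      ... | suc (suc _) | s≤s (s≤s ())
      generates : n % 2 ≡ 1 → Generates S
      generates r≡1 with K , n≡ ← %≡1⇒≡1+multiple 2 1<n r≡1 =
        generates-if-adjacent (adjacent-if-residues λ where
          0             _                  _ → 0⇄1
          1             _                  _ → d′⇄d {K} n≡
          (suc (suc _)) (s≤s (s≤s ())) _)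

  -- Position a lies in block q = ⌊(a + 1)/3⌋. Below n = 6J + 4, r_n sends block q to
  -- 2J + 1 − q; below m = 6J + 1, r_m sends it to 2J − q. So r_n flips the parity of the
  -- block, while r_m and r_2 keep it.
  ¬generates-if-n≡4+6J : ∀ {J} → m + 3 ≡ n → n ≡ 4 + J * 6 → ¬ Generates (reversals 2<m m<n)
  ¬generates-if-n≡4+6J {J} m+3≡n n≡4+6J =
    ¬generates-if-invariant SameParity invₙ (subst (Invariant SameParity) (sym m≡) invₘ)
      (kernel-invariant parity (λ x → x) {2} (λ {a} _ → label-reflect₂ parity refl a))
      refl (λ ()) z<s 2<n
    where
      open Reversals n m 2 m+3≡n 2<m m<n
      parity : ℕ → ℕ
      parity a = suc a / 3 % 2
      SameParity : ℕ → ℕ → Set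
      SameParity a b = parity a ≡ parity b
      n≡ : n ≡ suc (suc (2 * J) * 3)
      n≡ = trans n≡4+6J (regroup J)
        where regroup : ∀ J → 4 + J * 6 ≡ suc (suc (2 * J) * 3)
              regroup = solve-∀
      m≡ : m ≡ suc (2 * J * 3)
      m≡ = +-cancelʳ-≡ 3 m _ (trans m+3≡n (trans n≡ (regroup J)))
        where regroup : ∀ J → suc (suc (2 * J) * 3) ≡ suc (2 * J * 3) + 3
              regroup = solve-∀
      invₙ : Invariant SameParity n
      invₙ {a} {b} a<n b<n pa≡pb = begin
        parity (reflect n a)        ≡⟨ cong (_% 2) (reflect-suc-/ K 3 (cong (suc ∘ suc) n≡) a<n) ⟩
        reflect K (suc a / 3) % 2   ≡⟨ reflect-%-cong 2 (block<K a<n) (block<K b<n) pa≡pb ⟩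
        reflect K (suc b / 3) % 2   ≡⟨ cong (_% 2) (reflect-suc-/ K 3 (cong (suc ∘ suc) n≡) b<n) ⟨
        parity (reflect n b)        ∎
        where
          open ≡-Reasoning
          K : ℕ
          K = suc (suc (2 * J))
          block<K : ∀ {x} → x < n → suc x / 3 < K
          block<K {x} x<n = m<n*o⇒m/o<n {suc x} {K} {3}
            (subst (suc x <_) (cong (suc ∘ suc) n≡) (<-trans (s≤s x<n) (n<1+n _)))
      invₘ : Invariant SameParity (suc (2 * J * 3))
      invₘ = kernel-invariant parity (λ x → x) {suc (2 * J * 3)} λ {a} _ → fixed a
        where
          fixed : ∀ a → parity (reflect (suc (2 * J * 3)) a) ≡ parity a
          fixed a with <-≤-connex a (suc (2 * J * 3))
          ... | inj₁ a<m = trans (cong (_% 2) (reflect-suc-/ (suc (2 * J)) 3 refl a<m))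
                                 (reflect-odd-%2 J (m<n*o⇒m/o<n {suc a} {suc (2 * J)} {3}
                                                                  (<-trans (s≤s a<m) (n<1+n _))))
          ... | inj₂ m≤a = cong parity (reflect-≥ m≤a)

  generates⇔gap3 : m + 3 ≡ n → Generates (reversals 2<m m<n) ⇔ n % 6 ≡ 1
  generates⇔gap3 m+3≡n = mk⇔ residue generates
    where
      open Reversals n m 2 m+3≡n 2<m m<n
      n%6%3≡n%3 : n % 6 % 3 ≡ n % 3
      n%6%3≡n%3 = m∣n⇒o%n%m≡o%m 3 6 n (divides 2 refl)
      ¬generates-if-n%3≡0 : n % 3 ≡ 0 → ¬ Generates S
      ¬generates-if-n%3≡0 r≡0 = ¬generates-if-blocks (s≤s (s≤s z≤n)) (m%n≡0⇒n∣m n 3 r≡0) ∣-refl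
      ¬generates-if-n%3≡2 : n % 3 ≡ 2 → ¬ Generates S
      ¬generates-if-n%3≡2 r≡2 = ¬generates-if-2≤n%d ≤-refl (subst (2 ≤_) (sym r≡2) ≤-refl)
      residue : Generates S → n % 6 ≡ 1
      residue all with n % 6 in r≡ | m%n<n n 6
      ... | 0 | _ = contradiction all (¬generates-if-n%3≡0 (trans (sym n%6%3≡n%3) (cong (_% 3) r≡)))
      ... | 1 | _ = refl
      ... | 2 | _ = contradiction all (¬generates-if-n%3≡2 (trans (sym n%6%3≡n%3) (cong (_% 3) r≡)))
      ... | 3 | _ = contradiction all (¬generates-if-n%3≡0 (trans (sym n%6%3≡n%3) (cong (_% 3) r≡)))
      ... | 4 | _ = contradiction all
                      (¬generates-if-n≡4+6J {n / 6} m+3≡n (trans (m≡m%n+[m/n]*n n 6) (cong (_+ n / 6 * 6) r≡)))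
      ... | 5 | _ = contradiction all (¬generates-if-n%3≡2 (trans (sym n%6%3≡n%3) (cong (_% 3) r≡)))
      ... | suc (suc (suc (suc (suc (suc _))))) | s≤s (s≤s (s≤s (s≤s (s≤s (s≤s ())))))
      generates : n % 6 ≡ 1 → Generates S
      generates r≡1 with J , n≡ ← %≡1⇒≡1+multiple 6 1<n r≡1 =
        generates-if-adjacent (adjacent-if-residues λ where
          0 _ _ → 0⇄1
          1 _ _ → 1⇄d′ {J} n≡′
          2 _ _ → d′⇄d {suc (2 * J)} n≡′
          (suc (suc (suc _))) (s≤s (s≤s (s≤s ()))) _)
        where
          n≡′ : n ≡ suc (suc (suc (2 * J)) * 3)
          n≡′ = trans n≡ (cong suc (regroup J))
            where regroup : ∀ J → suc J * 6 ≡ suc (suc (2 * J)) * 3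
                  regroup = solve-∀

  ¬generates-gap4 : m + 4 ≡ n → ¬ Generates (reversals 2<m m<n)
  ¬generates-gap4 m+4≡n = by-residue
    where
      open Reversals n m 3 m+4≡n 2<m m<n
      by-residue : ¬ Generates S
      by-residue with n % 4 in r≡ | m%n<n n 4
      ... | 0 | _ = ¬generates-if-blocks ≤-refl (∣-trans (divides 2 refl) (m%n≡0⇒n∣m n 4 r≡)) (divides 2 refl)
      ... | 1 | _ = ¬generates-if-n%d≡1 ≤-refl r≡
      ... | 2 | _ = ¬generates-if-2≤n%d (n≤1+n 3) (subst (2 ≤_) (sym r≡) ≤-refl)
      ... | 3 | _ = ¬generates-if-2≤n%d (n≤1+n 3) (subst (2 ≤_) (sym r≡) (n≤1+n 2))
      ... | suc (suc (suc (suc _))) | s≤s (s≤s (s≤s (s≤s ())))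

GeneratingGap : ℕ → ℕ → Set
GeneratingGap 1 n = ⊤
GeneratingGap 2 n = n % 2 ≡ 1
GeneratingGap 3 n = n % 6 ≡ 1
GeneratingGap _ n = ⊥

generates⇔gap : ∀ {n m d} (2<m : 2 < m) (m<n : m < n) → m + d ≡ n →
                Generates (reversals 2<m m<n) ⇔ GeneratingGap d n
generates⇔gap {m = m} {0} 2<m m<n m+0≡n = contradiction (trans (sym (+-identityʳ m)) m+0≡n) (<⇒≢ m<n)
generates⇔gap {d = 1} 2<m m<n m+1≡n = mk⇔ _ (λ _ → generates-gap1 2<m m<n m+1≡n)
generates⇔gap {d = 2} 2<m m<n m+2≡n = generates⇔gap2 2<m m<n m+2≡n
generates⇔gap {d = 3} 2<m m<n m+3≡n = generates⇔gap3 2<m m<n m+3≡n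
generates⇔gap {d = 4} 2<m m<n m+4≡n = mk⇔ (¬generates-gap4 2<m m<n m+4≡n) ⊥-elim
generates⇔gap {n} {m} {suc d′@(suc (suc (suc (suc _))))} 2<m m<n m+d≡n =
  mk⇔ (¬generates-if-5≤d (s≤s (s≤s (s≤s (s≤s (s≤s z≤n)))))) ⊥-elim
  where open Reversals n m d′ m+d≡n 2<m m<n

GeneratingCondition : ℕ → ℕ → Set
GeneratingCondition n m =
  (n % 2 ≡ 0 × m ≡ n ∸ 1)
  ⊎ (n % 2 ≡ 1 ×
     (((n % 3 ≡ 0 ⊎ n % 3 ≡ 2) × (m ≡ n ∸ 1 ⊎ m ≡ n ∸ 2))
      ⊎ (n % 3 ≡ 1 × (m ≡ n ∸ 3 ⊎ m ≡ n ∸ 2 ⊎ m ≡ n ∸ 1))))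

%2-cases : ∀ n → n % 2 ≡ 0 ⊎ n % 2 ≡ 1
%2-cases n with n % 2 | m%n<n n 2
... | 0           | _ = inj₁ refl
... | 1           | _ = inj₂ refl
... | suc (suc _) | s≤s (s≤s ())

%3-cases : ∀ n → n % 3 ≡ 0 ⊎ n % 3 ≡ 1 ⊎ n % 3 ≡ 2
%3-cases n with n % 3 | m%n<n n 3
... | 0                 | _ = inj₁ refl
... | 1                 | _ = inj₂ (inj₁ refl)
... | 2                 | _ = inj₂ (inj₂ refl)
... | suc (suc (suc _)) | s≤s (s≤s (s≤s ()))

%6≡1⇔ : ∀ n → n % 6 ≡ 1 ⇔ (n % 2 ≡ 1 × n % 3 ≡ 1)
%6≡1⇔ n = mk⇔ (λ r≡1 → trans (sym (%2 n)) (cong (_% 2) r≡1) , trans (sym (%3 n)) (cong (_% 3) r≡1)) from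
  where
    %2 : ∀ n → n % 6 % 2 ≡ n % 2
    %2 n = m∣n⇒o%n%m≡o%m 2 6 n (divides 3 refl)
    %3 : ∀ n → n % 6 % 3 ≡ n % 3
    %3 n = m∣n⇒o%n%m≡o%m 3 6 n (divides 2 refl)
    from : n % 2 ≡ 1 × n % 3 ≡ 1 → n % 6 ≡ 1
    from (odd , r₃≡1) with n % 6 in r≡ | m%n<n n 6
    ... | 1 | _ = refl
    ... | 0 | _ with () ← trans (sym odd) (trans (sym (%2 n)) (cong (_% 2) r≡))
    ... | 2 | _ with () ← trans (sym odd) (trans (sym (%2 n)) (cong (_% 2) r≡))
    ... | 3 | _ with () ← trans (sym r₃≡1) (trans (sym (%3 n)) (cong (_% 3) r≡))
    ... | 4 | _ with () ← trans (sym odd) (trans (sym (%2 n)) (cong (_% 2) r≡))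
    ... | 5 | _ with () ← trans (sym r₃≡1) (trans (sym (%3 n)) (cong (_% 3) r≡))
    ... | suc (suc (suc (suc (suc (suc _))))) | s≤s (s≤s (s≤s (s≤s (s≤s (s≤s ())))))

gap⇔condition : ∀ {n m d} → 3 ≤ n → m + d ≡ n → GeneratingGap d n ⇔ GeneratingCondition n m
gap⇔condition {n} {m} {d} 3≤n m+d≡n = mk⇔ (to d m+d≡n) from
  where
    m≡n∸ : ∀ {k} → m + k ≡ n → m ≡ n ∸ k
    m≡n∸ {k} m+k≡n = sym (trans (cong (_∸ k) (sym m+k≡n)) (m+n∸n≡m m k))
    by-n%3 : m ≡ n ∸ 1 ⊎ m ≡ n ∸ 2 →
             ((n % 3 ≡ 0 ⊎ n % 3 ≡ 2) × (m ≡ n ∸ 1 ⊎ m ≡ n ∸ 2)) ⊎ (n % 3 ≡ 1 × (m ≡ n ∸ 3 ⊎ m ≡ n ∸ 2 ⊎ m ≡ n ∸ 1))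
    by-n%3 m≡ with %3-cases n | m≡
    ... | inj₁ r≡0        | _         = inj₁ (inj₁ r≡0 , m≡)
    ... | inj₂ (inj₂ r≡2) | _         = inj₁ (inj₂ r≡2 , m≡)
    ... | inj₂ (inj₁ r≡1) | inj₁ m≡n∸1 = inj₂ (r≡1 , inj₂ (inj₂ m≡n∸1))
    ... | inj₂ (inj₁ r≡1) | inj₂ m≡n∸2 = inj₂ (r≡1 , inj₂ (inj₁ m≡n∸2))
    to : ∀ d → m + d ≡ n → GeneratingGap d n → GeneratingCondition n m
    to 1 m+1≡n _ with %2-cases n
    ... | inj₁ even = inj₁ (even , m≡n∸ m+1≡n)
    ... | inj₂ odd  = inj₂ (odd , by-n%3 (inj₁ (m≡n∸ m+1≡n)))
    to 2 m+2≡n odd = inj₂ (odd , by-n%3 (inj₂ (m≡n∸ m+2≡n)))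
    to 3 m+3≡n r≡1 with odd , r₃≡1 ← Equivalence.to (%6≡1⇔ n) r≡1 =
      inj₂ (odd , inj₂ (r₃≡1 , inj₁ (m≡n∸ m+3≡n)))
    gap : ∀ {k} → k ≤ 3 → m ≡ n ∸ k → GeneratingGap k n → GeneratingGap d n
    gap {k} k≤3 m≡n∸k = subst (λ x → GeneratingGap x n) (sym d≡k)
      where
        d≡k : d ≡ k
        d≡k = begin
          d             ≡⟨ m+n∸m≡n m d ⟨
          m + d ∸ m     ≡⟨ cong (_∸ m) m+d≡n ⟩
          n ∸ m         ≡⟨ cong (n ∸_) m≡n∸k ⟩
          n ∸ (n ∸ k)   ≡⟨ m∸[m∸n]≡n (≤-trans k≤3 3≤n) ⟩
          k             ∎
          where open ≡-Reasoning
    from : GeneratingCondition n m → GeneratingGap d n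
    from (inj₁ (_ , m≡n∸1))                             = gap {1} (s≤s z≤n) m≡n∸1 _
    from (inj₂ (_   , inj₁ (_ , inj₁ m≡n∸1)))            = gap {1} (s≤s z≤n) m≡n∸1 _
    from (inj₂ (odd , inj₁ (_ , inj₂ m≡n∸2)))            = gap {2} (s≤s (s≤s z≤n)) m≡n∸2 odd
    from (inj₂ (odd , inj₂ (r₃≡1 , inj₁ m≡n∸3)))         =
      gap {3} ≤-refl m≡n∸3 (Equivalence.from (%6≡1⇔ n) (odd , r₃≡1))
    from (inj₂ (odd , inj₂ (_ , inj₂ (inj₁ m≡n∸2))))     = gap {2} (s≤s (s≤s z≤n)) m≡n∸2 odd
    from (inj₂ (_   , inj₂ (_ , inj₂ (inj₂ m≡n∸1))))     = gap {1} (s≤s z≤n) m≡n∸1 _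

mainTheorem3 : (n m : ℕ) → 4 ≤ n → (2<m : 2 < m) → (m<n : m < n) →
    Generates (r n ≤-refl ∷ r m (<⇒≤ m<n) ∷ r 2 (<⇒≤ (<-trans 2<m m<n)) ∷ [])
    ⇔ ((n % 2 ≡ 0 × m ≡ n ∸ 1)
       ⊎ (n % 2 ≡ 1 ×
          (((n % 3 ≡ 0 ⊎ n % 3 ≡ 2) × (m ≡ n ∸ 1 ⊎ m ≡ n ∸ 2))
           ⊎ (n % 3 ≡ 1 × (m ≡ n ∸ 3 ⊎ m ≡ n ∸ 2 ⊎ m ≡ n ∸ 1)))))
mainTheorem3 n m 4≤n 2<m m<n =
  gap⇔condition (≤-trans (n≤1+n 3) 4≤n) m+d≡n ⇔-∘ generates⇔gap 2<m m<n m+d≡n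
  where
    m+d≡n : m + (n ∸ m) ≡ n
    m+d≡n = m+[n∸m]≡n (<⇒≤ m<n)
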